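{- Let $\alpha$ be a positive rational number and let $\mathcal P_\alpha=(P,\nu)$ be a maximal primitive factorization tree for $\alpha$. Let $r,s$ be vertices of $P$ with $s$ a descendant of $r$. Suppose $\nu(r)=(a_1/b_1,\dots,a_\ell/b_\ell,1,1,\dots)$ with $a_\ell/b_\ell\ne1$ and $\nu(s)=(c_1/d_1,c_2/d_2,\dots)$. Then $m(a_i/b_i)=m(c_i/d_i)$ for all $1\le i\le\ell$, where $m(x/y)=\log\max\{x,y\}$.
   Context: Write $\alpha=a/b$ with $a,b$ coprime positive integers. Let $p_1\ge\cdots\ge p_N$ be the primes dividing $ab$, listed with multiplicity. Put $\gamma(i)=1$ if $p_i\mid a$, $\gamma(i)=-1$ if $p_i\mid b$, and $\alpha_n=\prod_{i=1}^n p_i^{\gamma(i)}$ for $0\le n\le N$. A factorization of a positive rational $\beta$ is a sequence $(a_1/b_1,a_2/b_2,\dots)$ with $a_i,b_i$ positive integers, $a_i=b_i=1$ for all but finitely many $i$, $\prod_i a_i/b_i=\beta$, $\max\{a_i,b_i\}\ge\max\{a_{i+1},b_{i+1}\}$ for all $i$, and $\gcd(a_i,b_j)=1$ for all $i,j$. Let $\mathfrak F_\alpha$ be the set of factorizations of $\alpha_n$, $0\le n\le N$. For $0\le n<N$, a factorization $(a_i/b_i)$ of $\alpha_n$ is a direct subfactorization of a factorization $(c_i/d_i)$ of $\alpha_{n+1}$ if either $p_{n+1}\mid a$ and for some $k$: $d_i=b_i$ for all $i$, $c_i=a_i$ for $i\ne k$, $c_k=a_kp_{n+1}$; or $p_{n+1}\mid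 b$ and for some $k$: $c_i=a_i$ for all $i$, $d_i=b_i$ for $i\ne k$, $d_k=b_kp_{n+1}$. A factorization tree for $\alpha$ is a pair $(T,\nu)$ with $T$ a rooted tree and $\nu:V(T)\to\mathfrak F_\alpha$, with parenting map $\phi$ and $\mathcal C(r)$ the set of children of $r$, such that: (1) root $r_0$ has $\nu(r_0)=(1,1,\dots)$; (2) if $n<N$ and $\nu(r)$ is a factorization of $\alpha_n$ then $r$ has a child; (3) $\nu(r)=\nu(s)$ and $\phi(r)=\phi(s)$ imply $r=s$; (4) for non-root $r$, $\nu(\phi(r))$ is a direct subfactorization of $\nu(r)$. For $0\le n<N$ and a factorization $\mathbf A=(a_1/b_1,\dots,a_\ell/b_\ell,1,1,\dots)$ of $\alpha_n$ with $a_\ell/b_\ell\ne1$ ($\ell=0$ if $\mathbf A=(1,1,\dots)$): if $p_{n+1}\mid a$, $\delta(\mathbf A)$ is the set of sequences obtained from $\mathbf A$ by replacing $a_k/b_k$ by $a_kp_{n+1}/b_k$ for some $k$ with $a_kp_{n+1}<b_k$, and $\epsilon(\mathbf A)=\{(a_1/b_1,\dots,a_\ell/b_\ell,p_{n+1}/1,1,\dots)\}$; if $p_{n+1}\mid b$, $\delta(\mathbf A)$ consists of sequences obtained by replacing $a_k/b_k$ by $a_k/(b_kp_{n+1})$ for some $k$ with $b_kp_{n+1}<a_k$, and $\epsilon(\mathbf A)=\{(a_1/b_1,\dots,a_\ell/b_\ell,1/p_{n+1},1,\dots)\}$. $\Delta(\mathbf A)=\delta(\mathbf A)\cup\epsilon(\mathbf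 A)$. A maximal primitive factorization tree for $\alpha$ is a factorization tree with $\nu(\mathcal C(r))=\Delta(\nu(r))$ for every non-leaf vertex $r$. -}

module Defs where

open import Data.Nat using (ℕ; zero; suc; _*_; _≤_; _<_; _⊔_)
open import Data.Nat.Divisibility using (_∣_; _∣?_)
open import Data.Nat.Coprimality using (Coprime)
open import Data.Nat.Primality using (Prime)
open import Data.Product using (Σ; ∃; ∃-syntax; _×_; _,_; proj₁; proj₂)
open import Data.Sum using (_⊎_)
open import Data.Bool using (if_then_else_)
open import Data.Maybe using (Maybe; just; nothing)
open import Relation.Nullary using (¬_; does)
open import Relation.Binary.PropositionalEquality using (_≡_; _≢_)

-- A sequence of fractions a_i/b_i, indexed from 0, stored as pairs (a_i , b_i).
Seq : Set
Seq = ℕ → ℕ × ℕ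

num den : ℕ × ℕ → ℕ
num = proj₁
den = proj₂

-- max{a,b};  m(a/b) = log max{a,b}, and log is injective on positive reals.
mx : ℕ × ℕ → ℕ
mx q = num q ⊔ den q

prodTo : (ℕ → ℕ) → ℕ → ℕ
prodTo f zero    = 1
prodTo f (suc n) = prodTo f n * f n

-- The setting: alpha = a/b, and p 0 ≥ p 1 ≥ ... ≥ p (N-1) are the primes
-- dividing ab with multiplicity (paper's p_{i+1} is p i here).
-- Numerator/denominator of alpha_n = prod_{i<n} p_i^{gamma(i)} (coprime by construction).
αnum : (a : ℕ) (p : ℕ → ℕ) → ℕ → ℕ
αnum a p = prodTo (λ i → if does (p i ∣? a) then p i else 1)

αden : (b : ℕ) (p : ℕ → ℕ) → ℕ → ℕ
αden b p = prodTo (λ i → if does (p i ∣? b) then p i else 1)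

IsFactorization : ℕ → ℕ → Seq → Set
IsFactorization x y f =
    (∀ i → 1 ≤ num (f i) × 1 ≤ den (f i))
  × (∃[ L ] ((∀ i → L ≤ i → f i ≡ (1 , 1))
            × prodTo (λ i → num (f i)) L * y ≡ x * prodTo (λ i → den (f i)) L))
  × (∀ i → mx (f (suc i)) ≤ mx (f i))
  × (∀ i j → Coprime (num (f i)) (den (f j)))

IsFactOf : (a b : ℕ) (p : ℕ → ℕ) → ℕ → Seq → Set
IsFactOf a b p n f = IsFactorization (αnum a p n) (αden b p n) f

-- A = (a_1/b_1,...,a_ℓ/b_ℓ,1,1,...) with a_ℓ/b_ℓ ≠ 1 (0-indexed: entries i ≥ ℓ are 1)
IsLen : Seq → ℕ → Set
IsLen A ℓ = (∀ i → ℓ ≤ i → A i ≡ (1 , 1))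
          × (∀ m → ℓ ≡ suc m → num (A m) ≢ den (A m))

-- A (factorization of alpha_n) is a direct subfactorization of C (of alpha_{n+1});
-- q stands for p_{n+1}
DirectSub : (a b q : ℕ) → Seq → Seq → Set
DirectSub a b q A C =
    (q ∣ a × ∃[ k ] ((∀ i → den (C i) ≡ den (A i))
                    × (∀ i → i ≢ k → num (C i) ≡ num (A i))
                    × num (C k) ≡ num (A k) * q))
  ⊎ (q ∣ b × ∃[ k ] ((∀ i → num (C i) ≡ num (A i))
                    × (∀ i → i ≢ k → den (C i) ≡ den (A i))
                    × den (C k) ≡ den (A k) * q))

-- C ∈ Δ(A) = δ(A) ∪ ε(A), q stands for p_{n+1}
InΔ : (a b q : ℕ) → Seq → Seq → Set
InΔ a b q A C =
    (q ∣ a × ( (∃[ k ] (num (A k) * q < den (A k)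
                        × (∀ i → i ≢ k → C i ≡ A i)
                        × C k ≡ (num (A k) * q , den (A k))))
             ⊎ (∃[ ℓ ] (IsLen A ℓ × (∀ i → i ≢ ℓ → C i ≡ A i) × C ℓ ≡ (q , 1)))))
  ⊎ (q ∣ b × ( (∃[ k ] (den (A k) * q < num (A k)
                        × (∀ i → i ≢ k → C i ≡ A i)
                        × C k ≡ (num (A k) , den (A k) * q)))
             ⊎ (∃[ ℓ ] (IsLen A ℓ × (∀ i → i ≢ ℓ → C i ≡ A i) × C ℓ ≡ (1 , q)))))

module _ {V : Set} (root : V) (parent : V → Maybe V) where
  data Reach : V → Set where
    atRoot : Reach root
    up     : ∀ {u v} → parent v ≡ just u → Reach u → Reach v

data Desc {V : Set} (parent : V → Maybe V) (r : V) : V → Set where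
  child : ∀ {s} → parent s ≡ just r → Desc parent r s
  below : ∀ {u s} → parent s ≡ just u → Desc parent r u → Desc parent r s

record FactTree (a b N : ℕ) (p : ℕ → ℕ) : Set₁ where
  field
    V       : Set
    root    : V
    parent  : V → Maybe V
    root-parent : parent root ≡ nothing
    only-root   : ∀ v → parent v ≡ nothing → v ≡ root
    reach   : ∀ v → Reach root parent v
    ν       : V → Seq
    ν-in-𝔉  : ∀ v → ∃[ n ] (n ≤ N × IsFactOf a b p n (ν v))
    cond1   : ∀ i → ν root i ≡ (1 , 1)
    cond2   : ∀ r n → n < N → IsFactOf a b p n (ν r) → ∃[ c ] (parent c ≡ just r)
    -- (3)  (equality of factorizations = equality of sequences, pointwise)
    cond3   : ∀ r s u → parent r ≡ just u → parent s ≡ just u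
              → (∀ i → ν r i ≡ ν s i) → r ≡ s
    cond4   : ∀ v u → parent v ≡ just u
              → ∃[ n ] (n < N × IsFactOf a b p n (ν u) × IsFactOf a b p (suc n) (ν v)
                        × DirectSub a b (p n) (ν u) (ν v))

MaxPrimitive : ∀ {a b N p} → FactTree a b N p → Set
MaxPrimitive {a} {b} {N} {p} T =
  ∀ r → ∃[ c ] (parent c ≡ just r) → ∀ n → n < N → IsFactOf a b p n (ν r)
  → (∀ c → parent c ≡ just r → InΔ a b (p n) (ν r) (ν c))
  × (∀ C → InΔ a b (p n) (ν r) C → ∃[ c ] (parent c ≡ just r × (∀ i → ν c i ≡ C i)))
  where open FactTree T

module Submission where

-- Since log is injective we work with mx (x , y) = max{x,y}.  The argument:
--   * Passing from a vertex to a child applies one element of Δ.  A move in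
--     δ multiplies the smaller side of one fraction by a prime while keeping
--     it below the larger side, so that fraction's maximum is unchanged; the
--     move in ε only writes into the first trivial slot (value 1/1).  Hence
--     every entry with max ≠ 1 keeps its max (Δ-preserves-mx).
--   * The property "max ≠ 1" is then itself preserved, so induction on the
--     descendant relation extends this from children to all descendants.
--   * In a factorization the maxima are non-increasing, and the last
--     nontrivial entry a_ℓ/b_ℓ ≠ 1 has max ≥ 2; so all entries before the
--     length ℓ have max ≠ 1, which gives the theorem.

open import Defs
open import Data.Nat using (ℕ; suc; _*_; _≤_; _<_; _≤′_; ≤′-refl; ≤′-step; _⊔_; s≤s; NonZero)
open import Data.Nat.Properties
open import Data.Nat.Coprimality using (Coprime)
open import Data.Nat.Primality using (Prime; prime⇒nonZero)
open import Data.Product using (_×_; _,_; proj₁; proj₂)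
open import Data.Sum using (inj₁; inj₂)
open import Data.Maybe using (just)
open import Relation.Nullary using (yes; no; contradiction)
open import Relation.Binary.PropositionalEquality

max-one⇒equal : ∀ {x y} → 1 ≤ x → 1 ≤ y → x ⊔ y ≡ 1 → x ≡ y
max-one⇒equal {x} {y} 1≤x 1≤y x⊔y≡1 =
  trans (≤-antisym (subst (x ≤_) x⊔y≡1 (m≤m⊔n x y)) 1≤x)
        (sym (≤-antisym (subst (y ≤_) x⊔y≡1 (m≤n⊔m x y)) 1≤y))

unbalanced⇒max≥2 : ∀ {x y} → 1 ≤ x → 1 ≤ y → x ≢ y → 2 ≤ x ⊔ y
unbalanced⇒max≥2 {x} {y} 1≤x 1≤y x≢y =
  ≤∧≢⇒< (≤-trans 1≤x (m≤m⊔n x y)) (λ 1≡x⊔y → x≢y (max-one⇒equal 1≤x 1≤y (sym 1≡x⊔y)))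

replace-smaller-num : ∀ {x x′ y} → x ≤ y → x′ ≤ y → x ⊔ y ≡ x′ ⊔ y
replace-smaller-num x≤y x′≤y = trans (m≤n⇒m⊔n≡n x≤y) (sym (m≤n⇒m⊔n≡n x′≤y))

replace-smaller-den : ∀ {x y y′} → y ≤ x → y′ ≤ x → x ⊔ y ≡ x ⊔ y′
replace-smaller-den y≤x y′≤x = trans (m≥n⇒m⊔n≡m y≤x) (sym (m≥n⇒m⊔n≡m y′≤x))

antitone : (g : ℕ → ℕ) → (∀ i → g (suc i) ≤ g i) → ∀ {i j} → i ≤′ j → g j ≤ g i
antitone g step ≤′-refl         = ≤-refl
antitone g step (≤′-step i≤′j) = ≤-trans (step _) (antitone g step i≤′j)

-- Entries of a factorization before its length are nontrivial: their maxima
-- dominate that of the last entry a_ℓ/b_ℓ ≠ 1, which is at least 2.  Only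
-- positivity of the entries and the ordering of their maxima are used.
nontrivial-before-length : ∀ {f ℓ i}
  → (∀ j → 1 ≤ num (f j) × 1 ≤ den (f j)) → (∀ j → mx (f (suc j)) ≤ mx (f j))
  → IsLen f ℓ → i < ℓ → mx (f i) ≢ 1
nontrivial-before-length {f} {suc m} positive decreasing (_ , last≢1) (s≤s i≤m) =
  >⇒≢ (≤-trans max-last≥2 (antitone (λ j → mx (f j)) decreasing (≤⇒≤′ i≤m)))
  where
    max-last≥2 : 2 ≤ mx (f m)
    max-last≥2 = unbalanced⇒max≥2 (proj₁ (positive m)) (proj₂ (positive m)) (last≢1 m refl)

agree-away-from : ∀ {A C : Seq} k → (∀ i → i ≢ k → C i ≡ A i)
  → ∀ i → (i ≡ k → mx (A i) ≡ mx (C i)) → mx (A i) ≡ mx (C i)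
agree-away-from k unchanged i at-k with i ≟ k
... | yes i≡k = at-k i≡k
... | no  i≢k = cong mx (sym (unchanged i i≢k))

Δ-preserves-mx : ∀ {a b q A C} → .{{NonZero q}} → InΔ a b q A C
  → ∀ i → mx (A i) ≢ 1 → mx (A i) ≡ mx (C i)
Δ-preserves-mx {q = q} (inj₁ (_ , inj₁ (k , aq<b , unchanged , Ck))) i _ =
  agree-away-from k unchanged i λ { refl →
    trans (replace-smaller-num (<⇒≤ (≤-<-trans (m≤m*n _ q) aq<b)) (<⇒≤ aq<b)) (sym (cong mx Ck)) }
Δ-preserves-mx {q = q} (inj₂ (_ , inj₁ (k , bq<a , unchanged , Ck))) i _ =
  agree-away-from k unchanged i λ { refl →
    trans (replace-smaller-den (<⇒≤ (≤-<-trans (m≤m*n _ q) bq<a)) (<⇒≤ bq<a)) (sym (cong mx Ck)) }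
Δ-preserves-mx (inj₁ (_ , inj₂ (ℓ , (trivial , _) , unchanged , _))) i nontrivial =
  agree-away-from ℓ unchanged i λ { refl → contradiction (cong mx (trivial ℓ ≤-refl)) nontrivial }
Δ-preserves-mx (inj₂ (_ , inj₂ (ℓ , (trivial , _) , unchanged , _))) i nontrivial =
  agree-away-from ℓ unchanged i λ { refl → contradiction (cong mx (trivial ℓ ≤-refl)) nontrivial }

module _ {a b N : ℕ} {p : ℕ → ℕ} (primes : ∀ i → i < N → Prime (p i))
         (T : FactTree a b N p) (maximal : MaxPrimitive T) where
  open FactTree T

  -- A child is obtained from its parent by a move in Δ (maximality), so
  -- nontrivial entries keep their maxima.
  child-preserves-mx : ∀ {u s} → parent s ≡ just u
    → ∀ i → mx (ν u i) ≢ 1 → mx (ν u i) ≡ mx (ν s i)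
  child-preserves-mx {u} {s} s↦u with cond4 s u s↦u
  ... | n , n<N , u-fact , _ =
    Δ-preserves-mx {{prime⇒nonZero (primes n n<N)}}
      (proj₁ (maximal u (s , s↦u) n n<N u-fact) s s↦u)

  -- Induction along the path: the preserved maximum stays ≠ 1.
  desc-preserves-mx : ∀ {r s} → Desc parent r s
    → ∀ i → mx (ν r i) ≢ 1 → mx (ν r i) ≡ mx (ν s i)
  desc-preserves-mx (child s↦r) = child-preserves-mx s↦r
  desc-preserves-mx {r} (below {u} s↦u r⇝u) i nontrivial =
    trans r≡u (child-preserves-mx s↦u i (λ u≡1 → nontrivial (trans r≡u u≡1)))
    where
      r≡u : mx (ν r i) ≡ mx (ν u i)
      r≡u = desc-preserves-mx r⇝u i nontrivial

lemma3p5 : (a b : ℕ) → 1 ≤ a → 1 ≤ b → Coprime a b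
    → (N : ℕ) (p : ℕ → ℕ)
    → (∀ i → i < N → Prime (p i))
    → (∀ i → suc i < N → p (suc i) ≤ p i)
    → prodTo p N ≡ a * b
    → (T : FactTree a b N p) → MaxPrimitive T
    → ∀ r s → Desc (FactTree.parent T) r s
    → ∀ ℓ → IsLen (FactTree.ν T r) ℓ
    → ∀ i → i < ℓ → mx (FactTree.ν T r i) ≡ mx (FactTree.ν T s i)
lemma3p5 a b _ _ _ N p primes _ _ T maximal r s r⇝s ℓ r-len i i<ℓ =
  desc-preserves-mx primes T maximal r⇝s i
    (nontrivial-before-length positive decreasing r-len i<ℓ)
  where
    r-fact : IsFactOf a b p (proj₁ (FactTree.ν-in-𝔉 T r)) (FactTree.ν T r)
    r-fact = proj₂ (proj₂ (FactTree.ν-in-𝔉 T r))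
    positive : ∀ j → 1 ≤ num (FactTree.ν T r j) × 1 ≤ den (FactTree.ν T r j)
    positive = proj₁ r-fact
    decreasing : ∀ j → mx (FactTree.ν T r (suc j)) ≤ mx (FactTree.ν T r j)
    decreasing = proj₁ (proj₂ (proj₂ r-fact))
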